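{- Let $H$ be a graph, let $x\in V(H)$ have degree 1, and let $w$ be the neighbor of $x$. If $H-x$ has a 4-assignment $L'$ that is $4_{out}$-forcing (respectively $2_{in}$-forcing, $2_{comp}$-forcing, $3_{in}$-forcing, $3_{out}$-forcing) for $w$, then $H$ has a 4-assignment $L$ that is $4_{out}$-forcing (respectively $2_{in}$-forcing, $2_{comp}$-forcing, $3_{out}$-forcing, $3_{in}$-forcing) for $x$.
   Context: A 4-assignment $L$ for a graph assigns to each vertex $v$ a set $L(v)$ of exactly 4 colors. A 2-fold $L$-coloring is a function $\varphi$ with $\varphi(v)\subseteq L(v)$, $|\varphi(v)|=2$ for all $v$, and $\varphi(x)\cap\varphi(y)=\emptyset$ for every edge $xy$. For a vertex $v$ and a 4-assignment $L$: $L$ is $2_{in}$-forcing (resp. $2_{comp}$-forcing) for $v$ if there are two 2-subsets $A,B$ of $L(v)$ with $|A\cap B|=1$ (resp. $A\cap B=\emptyset$) such that every 2-fold $L$-coloring $\varphi$ has $\varphi(v)\in\{A,B\}$; $L$ is $3_{in}$-forcing for $v$ if there is a color $c\in L(v)$ such that every 2-fold $L$-coloring $\varphi$ has $c\in\varphi(v)$ (so $\varphi(v)$ is one of the three 2-subsets containing $c$); $L$ is $3_{out}$-forcing for $v$ if there is a color $c\in L(v)$ such that every 2-fold $L$-coloring $\varphi$ has $c\notin\varphi(v)$; $L$ is $4_{out}$-forcing for $v$ if there are two 2-subsets $A,B$ of $L(v)$ with $|A\cap B|=1$ such that no 2-fold $L$-coloring $\varphi$ has $\varphi(v)\in\{A,B\}$.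 -}

module Defs where

open import Data.Nat using (ℕ; suc)
open import Data.Fin using (Fin; punchIn)
open import Data.Product using (Σ; ∃; _×_; _,_)
open import Data.Sum using (_⊎_)
open import Relation.Nullary using (¬_)
open import Data.Empty using (⊥)
open import Relation.Binary.PropositionalEquality using (_≡_)
open import Function.Definitions using (Injective)

ColorSet : Set₁
ColorSet = ℕ → Set

_⊆_ : ColorSet → ColorSet → Set
S ⊆ T = ∀ c → S c → T c

_≐_ : ColorSet → ColorSet → Set
S ≐ T = (S ⊆ T) × (T ⊆ S)

Disjoint : ColorSet → ColorSet → Set
Disjoint S T = ∀ c → S c → T c → ⊥

_∩_ : ColorSet → ColorSet → ColorSet
(S ∩ T) c = S c × T c

HasSize : ColorSet → ℕ → Set
HasSize S k = Σ (Fin k → ℕ) λ f → Injective _≡_ _≡_ f × (∀ c → S c → ∃ λ i → f i ≡ c) × (∀ i → S (f i))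

record Graph (n : ℕ) : Set₁ where
  field
    Adj    : Fin n → Fin n → Set
    sym    : ∀ {u v} → Adj u v → Adj v u
    irrefl : ∀ {v} → ¬ Adj v v
open Graph public

-- H - x : vertex i of H - x is the vertex punchIn x i of H
deleteVertex : ∀ {m} → Graph (suc m) → Fin (suc m) → Graph m
deleteVertex H x = record
  { Adj = λ i j → Adj H (punchIn x i) (punchIn x j)
  ; sym = sym H
  ; irrefl = irrefl H }

Assignment : ℕ → Set₁
Assignment n = Fin n → ColorSet

Is4Assignment : ∀ {n} → Assignment n → Set
Is4Assignment L = ∀ v → HasSize (L v) 4

Is2FoldColoring : ∀ {n} → Graph n → Assignment n → (Fin n → ColorSet) → Set
Is2FoldColoring G L φ =
  (∀ v → φ v ⊆ L v) × (∀ v → HasSize (φ v) 2) × (∀ u v → Adj G u v → Disjoint (φ u) (φ v))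

TwoSubset : ColorSet → ColorSet → Set
TwoSubset A S = (A ⊆ S) × HasSize A 2

module _ {n : ℕ} (G : Graph n) (L : Assignment n) (v : Fin n) where

  TwoInForcing : Set₁
  TwoInForcing = Σ ColorSet λ A → Σ ColorSet λ B →
    TwoSubset A (L v) × TwoSubset B (L v) × HasSize (A ∩ B) 1 ×
    (∀ φ → Is2FoldColoring G L φ → (φ v ≐ A) ⊎ (φ v ≐ B))

  TwoCompForcing : Set₁
  TwoCompForcing = Σ ColorSet λ A → Σ ColorSet λ B →
    TwoSubset A (L v) × TwoSubset B (L v) × Disjoint A B ×
    (∀ φ → Is2FoldColoring G L φ → (φ v ≐ A) ⊎ (φ v ≐ B))

  ThreeInForcing : Set₁
  ThreeInForcing = Σ ℕ λ c → L v c × (∀ φ → Is2FoldColoring G L φ → φ v c)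

  ThreeOutForcing : Set₁
  ThreeOutForcing = Σ ℕ λ c → L v c × (∀ φ → Is2FoldColoring G L φ → ¬ φ v c)

  FourOutForcing : Set₁
  FourOutForcing = Σ ColorSet λ A → Σ ColorSet λ B →
    TwoSubset A (L v) × TwoSubset B (L v) × HasSize (A ∩ B) 1 ×
    (∀ φ → Is2FoldColoring G L φ → ¬ (φ v ≐ A) × ¬ (φ v ≐ B))

HasForcing : ∀ {n} → (Graph n → Assignment n → Fin n → Set₁) → Graph n → Fin n → Set₁
HasForcing {n} P G v = Σ (Assignment n) λ L → Is4Assignment L × P G L v

-- Give x the list L′(w) of its neighbour w.  In a 2-fold coloring φ the sets
-- φ(x) and φ(w) are disjoint 2-subsets of the 4-set L′(w), so φ(x) is the
-- complement of φ(w) there, while φ restricted to H - x is an L′-coloring.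
module Submission where

open import Defs
open import Data.Nat using (ℕ; zero; suc; _+_; _<_; _≤_; s≤s)
open import Data.Nat.Properties using (_≟_; +-comm; +-suc; <⇒≱; n≮n; m≤n+m)
open import Data.Fin using (Fin; punchIn; splitAt; join; zero; suc)
open import Data.Fin.Properties using (any?; ¬∀⟶∃¬; injective⇒≤; splitAt-join; join-splitAt)
open import Data.Vec.Functional using (insertAt; tail)
open import Data.Vec.Functional.Properties using (insertAt-lookup; insertAt-punchIn)
open import Data.Product using (∃; _×_; _,_; proj₁; proj₂)
open import Data.Sum as ⊎ using (_⊎_; inj₁; inj₂; [_,_]; [_,_]′)
open import Data.Empty using (⊥-elim)
open import Function using (_∘_)
open import Function.Definitions using (Injective)
open import Relation.Nullary using (¬_; yes; no; contradiction)
open import Relation.Nullary.Decidable using (map′)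
open import Relation.Unary using (Decidable; _∪_; _∖_; ｛_｝)
open import Relation.Binary.PropositionalEquality as ≡ using (_≡_; refl; cong; subst)

≐-sym : ∀ {S T} → S ≐ T → T ≐ S
≐-sym (S⊆T , T⊆S) = T⊆S , S⊆T

≐-trans : ∀ {S T U} → S ≐ T → T ≐ U → S ≐ U
≐-trans (S⊆T , T⊆S) (T⊆U , U⊆T) = (λ c → T⊆U c ∘ S⊆T c) , (λ c → T⊆S c ∘ U⊆T c)

∖-cong : ∀ {S P Q} → P ≐ Q → (S ∖ P) ≐ (S ∖ Q)
∖-cong (P⊆Q , Q⊆P) = (λ c (Sc , ¬Pc) → Sc , ¬Pc ∘ Q⊆P c) , (λ c (Sc , ¬Qc) → Sc , ¬Qc ∘ P⊆Q c)

∖-involutive : ∀ {S A} → Decidable A → A ⊆ S → (S ∖ (S ∖ A)) ≐ A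
∖-involutive {S} {A} A? A⊆S = to , λ c Ac → A⊆S c Ac , λ (_ , ¬Ac) → ¬Ac Ac
  where
  to : (S ∖ (S ∖ A)) ⊆ A
  to c (Sc , ¬S∖Ac) with A? c
  ... | yes Ac = Ac
  ... | no ¬Ac = contradiction (Sc , ¬Ac) ¬S∖Ac

∖-∩ : ∀ {S A B} → ((S ∖ A) ∩ (S ∖ B)) ≐ (S ∖ (A ∪ B))
∖-∩ = (λ c ((Sc , ¬Ac) , (_ , ¬Bc)) → Sc , [ ¬Ac , ¬Bc ]′)
    , (λ c (Sc , ¬A∪Bc) → (Sc , ¬A∪Bc ∘ inj₁) , (Sc , ¬A∪Bc ∘ inj₂))

HasSize-resp-≐ : ∀ {S T k} → S ≐ T → HasSize S k → HasSize T k
HasSize-resp-≐ (S⊆T , T⊆S) (f , f-inj , f-onto , f∈S) =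
  f , f-inj , (λ c → f-onto c ∘ T⊆S c) , (λ i → S⊆T (f i) (f∈S i))

HasSize⇒Decidable : ∀ {S k} → HasSize S k → Decidable S
HasSize⇒Decidable {S} (f , _ , f-onto , f∈S) c =
  map′ (λ (i , fi≡c) → subst S fi≡c (f∈S i)) (f-onto c) (any? (λ i → f i ≟ c))

HasSize-｛｝ : ∀ e → HasSize ｛ e ｝ 1
HasSize-｛｝ e = (λ _ → e) , (λ { {zero} {zero} _ → refl }) , (λ c e≡c → zero , e≡c) , (λ _ → refl)

HasSize-∪ : ∀ {S T k l} → Disjoint S T → HasSize S k → HasSize T l → HasSize (S ∪ T) (k + l)
HasSize-∪ {S} {T} {k} {l} S#T (f , f-inj , f-onto , f∈S) (g , g-inj , g-onto , g∈T) =
  h ∘ splitAt k , splitAt-inj ∘ h-inj , onto , h∈ ∘ splitAt k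
  where
  h : Fin k ⊎ Fin l → ℕ
  h = [ f , g ]
  h-inj : Injective _≡_ _≡_ h
  h-inj {inj₁ i} {inj₁ j} fi≡fj = cong inj₁ (f-inj fi≡fj)
  h-inj {inj₁ i} {inj₂ j} fi≡gj = ⊥-elim (S#T _ (f∈S i) (subst T (≡.sym fi≡gj) (g∈T j)))
  h-inj {inj₂ i} {inj₁ j} gi≡fj = ⊥-elim (S#T _ (f∈S j) (subst T gi≡fj (g∈T i)))
  h-inj {inj₂ i} {inj₂ j} gi≡gj = cong inj₂ (g-inj gi≡gj)
  splitAt-inj : Injective _≡_ _≡_ (splitAt k {l})
  splitAt-inj {i} {j} eq = ≡.trans (≡.sym (join-splitAt k l i)) (≡.trans (cong (join k l) eq) (join-splitAt k l j))
  onto : ∀ c → (S ∪ T) c → ∃ λ i → h (splitAt k i) ≡ c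
  onto c (inj₁ Sc) = let (i , fi≡c) = f-onto c Sc in
    join k l (inj₁ i) , ≡.trans (cong h (splitAt-join k l (inj₁ i))) fi≡c
  onto c (inj₂ Tc) = let (i , gi≡c) = g-onto c Tc in
    join k l (inj₂ i) , ≡.trans (cong h (splitAt-join k l (inj₂ i))) gi≡c
  h∈ : ∀ s → (S ∪ T) (h s)
  h∈ (inj₁ i) = inj₁ (f∈S i)
  h∈ (inj₂ i) = inj₂ (g∈T i)

HasSize-∪-｛｝ : ∀ {T k e} → ¬ T e → HasSize T k → HasSize (T ∪ ｛ e ｝) (suc k)
HasSize-∪-｛｝ {T} {k} {e} ¬Te hT =
  subst (HasSize (T ∪ ｛ e ｝)) (+-comm k 1) (HasSize-∪ (λ c Tc e≡c → ¬Te (subst T (≡.sym e≡c) Tc)) hT (HasSize-｛｝ e))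

HasSize-⊆⇒≤ : ∀ {S T k n} → T ⊆ S → HasSize T k → HasSize S n → k ≤ n
HasSize-⊆⇒≤ {S} {T} {k} {n} T⊆S (g , g-inj , _ , g∈T) (f , _ , f-onto , _) = injective⇒≤ index-inj
  where
  index : Fin k → Fin n
  index i = proj₁ (f-onto (g i) (T⊆S _ (g∈T i)))
  f∘index : ∀ i → f (index i) ≡ g i
  f∘index i = proj₂ (f-onto (g i) (T⊆S _ (g∈T i)))
  index-inj : Injective _≡_ _≡_ index
  index-inj {i} {j} eq = g-inj (≡.trans (≡.sym (f∘index i)) (≡.trans (cong f eq) (f∘index j)))

HasSize-⊆⇒⊇ : ∀ {S T n} → T ⊆ S → HasSize T n → HasSize S n → S ⊆ T
HasSize-⊆⇒⊇ {S} {T} {n} T⊆S hT hS c Sc with HasSize⇒Decidable hT c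
... | yes Tc = Tc
... | no ¬Tc = contradiction (HasSize-⊆⇒≤ T∪c⊆S (HasSize-∪-｛｝ ¬Tc hT) hS) (n≮n n)
  where
  T∪c⊆S : (T ∪ ｛ c ｝) ⊆ S
  T∪c⊆S e (inj₁ Te) = T⊆S e Te
  T∪c⊆S e (inj₂ refl) = Sc

∃-∖ : ∀ {S T k n} → k < n → HasSize S n → HasSize T k → ∃ λ e → (S ∖ T) e
∃-∖ {S} {T} k<n hS@(f , _ , f-onto , f∈S) hT =
  let (i , ¬Tfi) = ¬∀⟶∃¬ _ (T ∘ f) (HasSize⇒Decidable hT ∘ f) S⊈T in f i , f∈S i , ¬Tfi
  where
  S⊈T : ¬ (∀ i → T (f i))
  S⊈T Tf = <⇒≱ k<n (HasSize-⊆⇒≤ (λ c Sc → subst T (proj₂ (f-onto c Sc)) (Tf _)) hS hT)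

HasSize-∖ : ∀ d {S T k} → HasSize S (d + k) → HasSize T k → T ⊆ S → HasSize (S ∖ T) d
HasSize-∖ zero hS hT T⊆S =
  (λ ()) , (λ { {()} }) , (λ c (Sc , ¬Tc) → contradiction (HasSize-⊆⇒⊇ T⊆S hT hS c Sc) ¬Tc) , (λ ())
HasSize-∖ (suc d) {S} {T} {k} hS hT T⊆S with ∃-∖ (s≤s (m≤n+m k d)) hS hT
... | e , Se , ¬Te =
  HasSize-resp-≐ (≐-sym split) (subst (HasSize _) (+-comm d 1) (HasSize-∪ disjoint rest (HasSize-｛｝ e)))
  where
  rest : HasSize (S ∖ (T ∪ ｛ e ｝)) d
  rest = HasSize-∖ d (subst (HasSize S) (≡.sym (+-suc d k)) hS) (HasSize-∪-｛｝ ¬Te hT)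
           λ { c (inj₁ Tc) → T⊆S c Tc ; c (inj₂ refl) → Se }
  disjoint : Disjoint (S ∖ (T ∪ ｛ e ｝)) ｛ e ｝
  disjoint c (_ , ¬T∪e) e≡c = ¬T∪e (inj₂ e≡c)
  split : (S ∖ T) ≐ ((S ∖ (T ∪ ｛ e ｝)) ∪ ｛ e ｝)
  split = to , λ { c (inj₁ (Sc , ¬T∪e)) → Sc , ¬T∪e ∘ inj₁ ; c (inj₂ refl) → Se , ¬Te }
    where
    to : (S ∖ T) ⊆ ((S ∖ (T ∪ ｛ e ｝)) ∪ ｛ e ｝)
    to c (Sc , ¬Tc) with e ≟ c
    ... | yes e≡c = inj₂ e≡c
    ... | no e≢c = inj₁ (Sc , [ ¬Tc , e≢c ]′)

disjoint⇒≐∖ : ∀ {S P Q k l} → HasSize S (l + k) → P ⊆ S → HasSize P k → Q ⊆ S → HasSize Q l →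
              Disjoint P Q → Q ≐ (S ∖ P)
disjoint⇒≐∖ {S} {P} {Q} {k} {l} hS P⊆S hP Q⊆S hQ P#Q =
  Q⊆S∖P , HasSize-⊆⇒⊇ Q⊆S∖P hQ (HasSize-∖ l hS hP P⊆S)
  where
  Q⊆S∖P : Q ⊆ (S ∖ P)
  Q⊆S∖P c Qc = Q⊆S c Qc , λ Pc → P#Q c Pc Qc

HasSize-∪-∩ : ∀ {A B k l j} → HasSize A k → HasSize B (l + j) → HasSize (A ∩ B) j → HasSize (A ∪ B) (k + l)
HasSize-∪-∩ {A} {B} {k} {l} hA hB hA∩B =
  HasSize-resp-≐ merge (HasSize-∪ disjoint hA (HasSize-∖ l hB hA∩B (λ _ → proj₂)))
  where
  disjoint : Disjoint A (B ∖ (A ∩ B))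
  disjoint c Ac (Bc , ¬A∩Bc) = ¬A∩Bc (Ac , Bc)
  merge : (A ∪ (B ∖ (A ∩ B))) ≐ (A ∪ B)
  merge = (λ { c (inj₁ Ac) → inj₁ Ac ; c (inj₂ (Bc , _)) → inj₂ Bc }) , from
    where
    from : (A ∪ B) ⊆ (A ∪ (B ∖ (A ∩ B)))
    from c (inj₁ Ac) = inj₁ Ac
    from c (inj₂ Bc) with HasSize⇒Decidable hA c
    ... | yes Ac = inj₁ Ac
    ... | no ¬Ac = inj₂ (Bc , ¬Ac ∘ proj₁)

∖-TwoSubset : ∀ {S A} → HasSize S 4 → TwoSubset A S → TwoSubset (S ∖ A) S
∖-TwoSubset hS (A⊆S , hA) = (λ _ → proj₁) , HasSize-∖ 2 hS hA A⊆S

HasSize-∖-∩-∖ : ∀ {S A B} → HasSize S 4 → TwoSubset A S → TwoSubset B S → HasSize (A ∩ B) 1 →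
                HasSize ((S ∖ A) ∩ (S ∖ B)) 1
HasSize-∖-∩-∖ hS (A⊆S , hA) (B⊆S , hB) hA∩B =
  HasSize-resp-≐ (≐-sym ∖-∩) (HasSize-∖ 1 hS (HasSize-∪-∩ hA hB hA∩B) (λ c → [ A⊆S c , B⊆S c ]′))

∀-insertAt : ∀ {a p} {A : Set a} {n} (P : A → Set p) (xs : Fin n → A) i {v} →
             P v → (∀ j → P (xs j)) → ∀ k → P (insertAt xs i v k)
∀-insertAt P xs zero Pv Pxs zero = Pv
∀-insertAt P xs zero Pv Pxs (suc k) = Pxs k
∀-insertAt {n = suc n} P xs (suc i) Pv Pxs zero = Pxs zero
∀-insertAt {n = suc n} P xs (suc i) Pv Pxs (suc k) = ∀-insertAt P (tail xs) i Pv (Pxs ∘ suc) k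

module PendantVertex {m} (H : Graph (suc m)) (x : Fin (suc m)) (w : Fin m)
  (x∼w : Adj H x (punchIn x w)) (L′ : Assignment m) (L′-4 : Is4Assignment L′) where

  S : ColorSet
  S = L′ w

  L : Assignment (suc m)
  L = insertAt L′ x S

  L-4 : Is4Assignment L
  L-4 = ∀-insertAt (λ T → HasSize T 4) L′ x (L′-4 w) L′-4

  S⊆Lx : S ⊆ L x
  S⊆Lx c = subst (λ U → U c) (≡.sym (insertAt-lookup L′ x S))

  TwoSubset-Lx : ∀ {T} → TwoSubset T S → TwoSubset T (L x)
  TwoSubset-Lx (T⊆S , hT) = (λ c → S⊆Lx c ∘ T⊆S c) , hT

  module _ {φ : Fin (suc m) → ColorSet} (φ-col : Is2FoldColoring H L φ) where

    restrict : Is2FoldColoring (deleteVertex H x) L′ (φ ∘ punchIn x)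
    restrict = (λ j c φc → subst (λ U → U c) (insertAt-punchIn L′ x S j) (proj₁ φ-col (punchIn x j) c φc))
             , (λ j → proj₁ (proj₂ φ-col) (punchIn x j))
             , (λ i j → proj₂ (proj₂ φ-col) (punchIn x i) (punchIn x j))

    φx⊆S : φ x ⊆ S
    φx⊆S c φc = subst (λ U → U c) (insertAt-lookup L′ x S) (proj₁ φ-col x c φc)

    φw⊆S : φ (punchIn x w) ⊆ S
    φw⊆S = proj₁ restrict w

    φx#φw : Disjoint (φ x) (φ (punchIn x w))
    φx#φw = proj₂ (proj₂ φ-col) x (punchIn x w) x∼w

    φx≐S∖φw : φ x ≐ (S ∖ φ (punchIn x w))
    φx≐S∖φw = disjoint⇒≐∖ (L′-4 w) φw⊆S (proj₁ (proj₂ restrict) w) φx⊆S (proj₁ (proj₂ φ-col) x)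
                           (λ c φwc φxc → φx#φw c φxc φwc)

    φw≐S∖φx : φ (punchIn x w) ≐ (S ∖ φ x)
    φw≐S∖φx = disjoint⇒≐∖ (L′-4 w) φx⊆S (proj₁ (proj₂ φ-col) x) φw⊆S (proj₁ (proj₂ restrict) w) φx#φw

    φw≐⇒φx≐S∖ : ∀ {A} → φ (punchIn x w) ≐ A → φ x ≐ (S ∖ A)
    φw≐⇒φx≐S∖ φw≐A = ≐-trans φx≐S∖φw (∖-cong φw≐A)

    φx≐S∖⇒φw≐ : ∀ {A} → TwoSubset A S → φ x ≐ (S ∖ A) → φ (punchIn x w) ≐ A
    φx≐S∖⇒φw≐ (A⊆S , hA) φx≐S∖A =
      ≐-trans φw≐S∖φx (≐-trans (∖-cong φx≐S∖A) (∖-involutive (HasSize⇒Decidable hA) A⊆S))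

  FourOut⇒FourOut : FourOutForcing (deleteVertex H x) L′ w → FourOutForcing H L x
  FourOut⇒FourOut (A , B , A⊂S , B⊂S , hA∩B , avoid) =
    S ∖ A , S ∖ B , TwoSubset-Lx (∖-TwoSubset (L′-4 w) A⊂S) , TwoSubset-Lx (∖-TwoSubset (L′-4 w) B⊂S) ,
    HasSize-∖-∩-∖ (L′-4 w) A⊂S B⊂S hA∩B ,
    λ φ φ-col → (proj₁ (avoid _ (restrict φ-col)) ∘ φx≐S∖⇒φw≐ φ-col A⊂S)
              , (proj₂ (avoid _ (restrict φ-col)) ∘ φx≐S∖⇒φw≐ φ-col B⊂S)

  TwoIn⇒TwoIn : TwoInForcing (deleteVertex H x) L′ w → TwoInForcing H L x
  TwoIn⇒TwoIn (A , B , A⊂S , B⊂S , hA∩B , forced) =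
    S ∖ A , S ∖ B , TwoSubset-Lx (∖-TwoSubset (L′-4 w) A⊂S) , TwoSubset-Lx (∖-TwoSubset (L′-4 w) B⊂S) ,
    HasSize-∖-∩-∖ (L′-4 w) A⊂S B⊂S hA∩B ,
    λ φ φ-col → ⊎.map (φw≐⇒φx≐S∖ φ-col) (φw≐⇒φx≐S∖ φ-col) (forced _ (restrict φ-col))

  TwoComp⇒TwoComp : TwoCompForcing (deleteVertex H x) L′ w → TwoCompForcing H L x
  TwoComp⇒TwoComp (A , B , (A⊆S , hA) , (B⊆S , hB) , A#B , forced) =
    B , A , TwoSubset-Lx (B⊆S , hB) , TwoSubset-Lx (A⊆S , hA) , (λ c Bc Ac → A#B c Ac Bc) ,
    λ φ φ-col → ⊎.map (λ φw≐A → ≐-trans (φw≐⇒φx≐S∖ φ-col φw≐A) (≐-sym B≐S∖A))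
                      (λ φw≐B → ≐-trans (φw≐⇒φx≐S∖ φ-col φw≐B) (≐-sym A≐S∖B))
                      (forced _ (restrict φ-col))
    where
    B≐S∖A : B ≐ (S ∖ A)
    B≐S∖A = disjoint⇒≐∖ (L′-4 w) A⊆S hA B⊆S hB A#B
    A≐S∖B : A ≐ (S ∖ B)
    A≐S∖B = disjoint⇒≐∖ (L′-4 w) B⊆S hB A⊆S hA (λ c Bc Ac → A#B c Ac Bc)

  ThreeIn⇒ThreeOut : ThreeInForcing (deleteVertex H x) L′ w → ThreeOutForcing H L x
  ThreeIn⇒ThreeOut (c , Sc , forced) =
    c , S⊆Lx c Sc , λ φ φ-col φxc → proj₂ (proj₁ (φx≐S∖φw φ-col) c φxc) (forced _ (restrict φ-col))

  ThreeOut⇒ThreeIn : ThreeOutForcing (deleteVertex H x) L′ w → ThreeInForcing H L x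
  ThreeOut⇒ThreeIn (c , Sc , avoided) =
    c , S⊆Lx c Sc , λ φ φ-col → proj₂ (φx≐S∖φw φ-col) c (Sc , avoided _ (restrict φ-col))

proposition11 : ∀ {m} (H : Graph (suc m)) (x : Fin (suc m)) (w : Fin m) →
    Adj H x (punchIn x w) →
    (∀ y → Adj H x y → y ≡ punchIn x w) →
    (HasForcing FourOutForcing (deleteVertex H x) w → HasForcing FourOutForcing H x) ×
    (HasForcing TwoInForcing (deleteVertex H x) w → HasForcing TwoInForcing H x) ×
    (HasForcing TwoCompForcing (deleteVertex H x) w → HasForcing TwoCompForcing H x) ×
    (HasForcing ThreeInForcing (deleteVertex H x) w → HasForcing ThreeOutForcing H x) ×
    (HasForcing ThreeOutForcing (deleteVertex H x) w → HasForcing ThreeInForcing H x)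
proposition11 H x w x∼w _ =
  lift FourOutForcing  FourOutForcing  FourOut⇒FourOut ,
  lift TwoInForcing    TwoInForcing    TwoIn⇒TwoIn ,
  lift TwoCompForcing  TwoCompForcing  TwoComp⇒TwoComp ,
  lift ThreeInForcing  ThreeOutForcing ThreeIn⇒ThreeOut ,
  lift ThreeOutForcing ThreeInForcing  ThreeOut⇒ThreeIn
  where
  open PendantVertex H x w x∼w
  lift : ∀ P Q → (∀ L′ L′-4 → P (deleteVertex H x) L′ w → Q H (L L′ L′-4) x) →
         HasForcing P (deleteVertex H x) w → HasForcing Q H x
  lift _ _ transfer (L′ , L′-4 , forcing) = L L′ L′-4 , L-4 L′ L′-4 , transfer L′ L′-4 forcing
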